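{- For all integers $b$, $m\ge 0$ and $k\ge 1$, and for any choice of the integers $c_b(p_ip_j)$ as described in the context, $$\sum_{\substack{b<a\le b+m\\ \omega_k(a)>0}}\bigl(\omega_k(a)-1\bigr)=\sum_{j=2}^{k}F_{b,m}(2p_j)+\sum_{i=2}^{k-1}\sum_{j=i+1}^{k}\varphi\bigl(c_b(p_ip_j),\,F_{b,m}(p_ip_j),\,i-1\bigr).$$
   Context: $p_i$ denotes the $i$-th prime ($p_1=2$) and $P_k=p_1\cdots p_k$. For an integer $a$, $\omega_k(a)$ is the number of indices $i\le k$ with $p_i\mid a$. For integers $b$, $m\ge0$, $d\ge1$, $F_{b,m}(d)$ is the number of integers $a$ with $b<a\le b+m$ and $d\mid a$. For integers $c$, $n\ge 0$, $t\ge1$, $\varphi(c,n,t)$ is the number of integers $a$ with $c<a\le c+n$ and $\gcd(a,P_t)=1$ (so $\varphi(c,0,t)=0$). For $2\le i<j$ and $d=p_ip_j$ (with $b,m$ fixed): if $F_{b,m}(d)\ge1$, let $y+d$ be the smallest integer in $\{b+1,\dots,b+m\}$ divisible by $d$; then $c_b(d)$ denotes an integer such that $\gcd(c_b(d)+x,P_{i-1})=\gcd(y+xd,P_{i-1})$ for all integers $x$ (such an integer exists). If $F_{b,m}(d)=0$, $c_b(d)$ is an arbitrary integer (the corresponding term is $0$). -}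

module Defs where

open import Data.Nat as ℕ using (ℕ; zero; suc; _∸_; _<_; _≤_; _<?_)
open import Data.Nat.Divisibility using (_∣?_)
open import Data.Nat.GCD using (gcd)
open import Data.Nat.Primality using (Prime)
open import Data.Integer as ℤ using (ℤ; +_; ∣_∣)
open import Data.List using (List; map; upTo; filter; length)
open import Data.Nat.ListAction using (sum; product)
open import Data.Product using (_×_; ∃)
open import Relation.Binary.PropositionalEquality using (_≡_)

-- p : ℕ → ℕ is the enumeration of the primes: p 1 = 2, p 2 = 3, ...
-- (values at index 0 are irrelevant).  The conditions below determine p i
-- uniquely for every i ≥ 1.
IsPrimeEnumeration : (ℕ → ℕ) → Set
IsPrimeEnumeration p =
  (∀ i → 1 ≤ i → Prime (p i)) ×
  (∀ i j → 1 ≤ i → i < j → p i < p j) ×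
  (∀ q → Prime q → ∃ λ i → 1 ≤ i × p i ≡ q)

fromTo : ℕ → ℕ → List ℕ
fromTo lo hi = map (lo ℕ.+_) (upTo (suc hi ∸ lo))

interval : ℤ → ℕ → List ℤ
interval b m = map (λ t → b ℤ.+ + suc t) (upTo m)

primorial : (ℕ → ℕ) → ℕ → ℕ
primorial p t = product (map p (fromTo 1 t))

omega : (ℕ → ℕ) → ℕ → ℤ → ℕ
omega p k a = length (filter (λ i → p i ∣? ∣ a ∣) (fromTo 1 k))

F : ℤ → ℕ → ℕ → ℕ
F b m d = length (filter (λ a → d ∣? ∣ a ∣) (interval b m))

phi : (ℕ → ℕ) → ℤ → ℕ → ℕ → ℕ
phi p c n t = length (filter (λ a → gcd ∣ a ∣ (primorial p t) ℕ.≟ 1) (interval c n))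

lhs : (ℕ → ℕ) → ℤ → ℕ → ℕ → ℕ
lhs p b m k =
  sum (map (λ a → omega p k a ∸ 1) (filter (λ a → 0 <? omega p k a) (interval b m)))

rhs : (ℕ → ℕ) → ℤ → ℕ → ℕ → (ℕ → ℕ → ℤ) → ℕ
rhs p b m k c =
  sum (map (λ j → F b m (2 ℕ.* p j)) (fromTo 2 k)) ℕ.+
  sum (map (λ i → sum (map (λ j → phi p (c i j) (F b m (p i ℕ.* p j)) (i ∸ 1))
                           (fromTo (suc i) k)))
           (fromTo 2 (k ∸ 1)))

IsFirstMultipleShift : ℤ → ℕ → ℕ → ℤ → Set
IsFirstMultipleShift b m d y =
  (b ℤ.< y ℤ.+ + d) × (y ℤ.+ + d ℤ.≤ b ℤ.+ + m) ×
  (d Data.Nat.Divisibility.∣ ∣ y ℤ.+ + d ∣) ×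
  (∀ a → b ℤ.< a → a ℤ.≤ b ℤ.+ + m → d Data.Nat.Divisibility.∣ ∣ a ∣ → y ℤ.+ + d ℤ.≤ a)

ValidC : (ℕ → ℕ) → ℤ → ℕ → ℕ → (ℕ → ℕ → ℤ) → Set
ValidC p b m k c =
  ∀ i j → 2 ≤ i → i < j → j ≤ k →
  1 ≤ F b m (p i ℕ.* p j) →
  ∀ y → IsFirstMultipleShift b m (p i ℕ.* p j) y →
  ∀ (x : ℤ) → gcd (∣ c i j ℤ.+ x ∣) (primorial p (i ∸ 1))
            ≡ gcd (∣ y ℤ.+ x ℤ.* + (p i ℕ.* p j) ∣) (primorial p (i ∸ 1))

-- Fix a and let p_i be the least of p_1, …, p_k dividing it.  Then ω_k(a) − 1 is the number
-- of j > i with p_j ∣ a, i.e. of the pairs i < j with p_i p_j ∣ a and gcd(a, P_{i−1}) = 1.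
-- Summing over a and exchanging the sums, the pairs with i = 1 (where p_1 = 2 and the gcd
-- condition is empty) contribute Σ_j F(2 p_j).  For i ≥ 2 the multiples of d = p_i p_j in
-- (b, b + m] are y + d, y + 2d, …, y + F(d)·d, and c_b(d) is chosen precisely so that
-- x ↦ c_b(d) + x transports coprimality with P_{i−1} from these multiples to the integers
-- c_b(d) + 1, …, c_b(d) + F(d); their count is therefore φ(c_b(d), F(d), i − 1).

module Submission where

open import Defs
open import Data.Bool using (Bool; true; false; _∧_; not)
open import Data.Bool.ListAction using (any; or)
open import Data.Bool.Properties using (∧-assoc; ∧-zeroʳ; ∧-identityʳ; ∨-∧-booleanAlgebra)
open import Algebra.Lattice.Properties.BooleanAlgebra ∨-∧-booleanAlgebra using (deMorgan₂)
open import Data.Integer as ℤ using (ℤ; ∣_∣)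
  renaming (_+_ to _+ᶻ_; _-_ to _-ᶻ_; _*_ to _*ᶻ_; _≤_ to _≤ᶻ_; _<_ to _<ᶻ_)
import Data.Integer.Divisibility.Signed as ℤ
import Data.Integer.Properties as ℤ
open import Data.Integer.Tactic.RingSolver renaming (solve-∀ to ℤ-solve-∀)
open import Data.List using (List; []; _∷_; map; filter; length; applyUpTo; upTo)
open import Data.List.Membership.Propositional using (_∈_)
open import Data.List.Membership.Propositional.Properties using (∈-map⁻; ∈-upTo⁻)
open import Data.List.Properties
  using (map-∘; map-cong; map-cong-local; map-applyUpTo; map-upTo; length-map; length-upTo)
open import Data.List.Relation.Unary.All as All using (All; []; _∷_)
import Data.List.Relation.Unary.All.Properties as All
open import Data.Nat
  using (ℕ; zero; suc; pred; _+_; _*_; _∸_; _≤_; _<_; z≤n; s≤s; _≟_; _<?_;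
         nonTrivial⇒≢1; nonTrivial⇒n>1; ≢-nonZero)
open import Data.Nat.Coprimality using (Coprime; gcd≡1⇒coprime; coprime⇒gcd≡1; coprime-divisor)
open import Data.Nat.Divisibility
  using (_∣_; _∣?_; divides; ∣⇒≤; m*n∣⇒m∣; m*n∣⇒n∣; *-monoʳ-∣; ∣m⇒∣m*n; ∣n⇒∣m*n; ∣-refl; ∣-trans)
open import Data.Nat.GCD using (gcd; gcd-zeroʳ)
open import Data.Nat.ListAction using (sum; product)
open import Data.Nat.Primality using (Prime; prime[2]; euclidsLemma; prime⇒irreducible; prime⇒nonTrivial)
open import Data.Nat.Properties
open import Data.Nat.Tactic.RingSolver using (solve-∀)
open import Data.Product using (_×_; _,_; proj₁; proj₂; uncurry; ∃)
open import Data.Product.Function.NonDependent.Propositional using (_×-⇔_)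
open import Data.Sum using (inj₁; inj₂)
open import Function using (_∘_)
open import Function.Bundles using (_⇔_; mk⇔)
open import Function.Construct.Composition using (_⇔-∘_)
open import Function.Construct.Symmetry using (⇔-sym)
open import Relation.Binary.PropositionalEquality
open import Relation.Nullary using (¬_; yes; no; does; contradiction; ¬?; _×-dec_)
open import Relation.Nullary.Decidable using (dec-true; does-⇔)
open import Relation.Unary using (Decidable)
open ≡-Reasoning

private variable
  A B : Set

indicator : Bool → ℕ
indicator true  = 1
indicator false = 0

count : (A → Bool) → List A → ℕ
count d xs = sum (map (indicator ∘ d) xs)

length-filter≡count : ∀ {P : A → Set} (P? : Decidable P) xs →
  length (filter P? xs) ≡ count (does ∘ P?) xs
length-filter≡count P? []       = refl
length-filter≡count P? (x ∷ xs) with does (P? x)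
... | true  = cong suc (length-filter≡count P? xs)
... | false = length-filter≡count P? xs

count-∧-filter : ∀ {P : A → Set} (P? : Decidable P) (d : A → Bool) xs →
  count (λ x → does (P? x) ∧ d x) xs ≡ count d (filter P? xs)
count-∧-filter P? d []       = refl
count-∧-filter P? d (x ∷ xs) with does (P? x)
... | true  = cong (indicator (d x) +_) (count-∧-filter P? d xs)
... | false = count-∧-filter P? d xs

count-∧ˡ : ∀ b (d : A → Bool) xs → count (λ x → b ∧ d x) xs ≡ indicator b * count d xs
count-∧ˡ true  d xs = sym (*-identityˡ (count d xs))
count-∧ˡ false d []       = refl
count-∧ˡ false d (x ∷ xs) = count-∧ˡ false d xs

count-cong : ∀ {d e : A → Bool} → (∀ x → d x ≡ e x) → ∀ xs → count d xs ≡ count e xs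
count-cong d≡e xs = cong sum (map-cong (cong indicator ∘ d≡e) xs)

count≤length : ∀ (d : A → Bool) xs → count d xs ≤ length xs
count≤length d []       = z≤n
count≤length d (x ∷ xs) with d x
... | true  = s≤s (count≤length d xs)
... | false = m≤n⇒m≤1+n (count≤length d xs)

sum-map-+ : ∀ (f g : A → ℕ) xs →
  sum (map (λ x → f x + g x) xs) ≡ sum (map f xs) + sum (map g xs)
sum-map-+ f g []       = refl
sum-map-+ f g (x ∷ xs) = begin
  f x + g x + sum (map (λ x → f x + g x) xs)
    ≡⟨ cong (f x + g x +_) (sum-map-+ f g xs) ⟩
  f x + g x + (sum (map f xs) + sum (map g xs))
    ≡⟨ +-+-interchange (f x) (g x) _ _ ⟩
  f x + sum (map f xs) + (g x + sum (map g xs)) ∎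
  where
  +-+-interchange : ∀ a b c e → a + b + (c + e) ≡ a + c + (b + e)
  +-+-interchange = solve-∀

sum-map-zero : ∀ (f : A → ℕ) xs → (∀ x → f x ≡ 0) → sum (map f xs) ≡ 0
sum-map-zero f []       f≡0 = refl
sum-map-zero f (x ∷ xs) f≡0 = cong₂ _+_ (f≡0 x) (sum-map-zero f xs f≡0)

sum-map-swap : ∀ (f : A → B → ℕ) xs ys →
  sum (map (λ x → sum (map (f x) ys)) xs) ≡ sum (map (λ y → sum (map (λ x → f x y) xs)) ys)
sum-map-swap f []       ys = sym (sum-map-zero (λ _ → 0) ys (λ _ → refl))
sum-map-swap f (x ∷ xs) ys = begin
  sum (map (f x) ys) + sum (map (λ x → sum (map (f x) ys)) xs)
    ≡⟨ cong (sum (map (f x) ys) +_) (sum-map-swap f xs ys) ⟩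
  sum (map (f x) ys) + sum (map (λ y → sum (map (λ x → f x y) xs)) ys)
    ≡⟨ sum-map-+ (f x) (λ y → sum (map (λ x → f x y) xs)) ys ⟨
  sum (map (λ y → sum (map (λ x → f x y) (x ∷ xs))) ys) ∎

sum-map-*ˡ : ∀ c (f : A → ℕ) xs → sum (map (λ x → c * f x) xs) ≡ c * sum (map f xs)
sum-map-*ˡ c f []       = sym (*-zeroʳ c)
sum-map-*ˡ c f (x ∷ xs) = trans (cong (c * f x +_) (sum-map-*ˡ c f xs)) (sym (*-distribˡ-+ c (f x) _))

sum-map-filter : ∀ {P : A → Set} (P? : Decidable P) (f : A → ℕ) xs →
  (∀ x → ¬ P x → f x ≡ 0) → sum (map f (filter P? xs)) ≡ sum (map f xs)
sum-map-filter P? f []       _   = refl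
sum-map-filter P? f (x ∷ xs) ¬P⇒0 with P? x
... | yes _  = cong (f x +_) (sum-map-filter P? f xs ¬P⇒0)
... | no ¬Px = trans (sum-map-filter P? f xs ¬P⇒0) (cong (_+ sum (map f xs)) (sym (¬P⇒0 x ¬Px)))

applyUpTo-cong : ∀ {f g : ℕ → A} → (∀ t → f t ≡ g t) → ∀ n → applyUpTo f n ≡ applyUpTo g n
applyUpTo-cong f≡g zero    = refl
applyUpTo-cong f≡g (suc n) = cong₂ _∷_ (f≡g 0) (applyUpTo-cong (f≡g ∘ suc) n)

count-applyUpTo-cong : ∀ (d : A → Bool) (f g : ℕ → A) → (∀ t → d (f t) ≡ d (g t)) →
  ∀ n → count d (applyUpTo f n) ≡ count d (applyUpTo g n)
count-applyUpTo-cong d f g df≡dg zero    = refl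
count-applyUpTo-cong d f g df≡dg (suc n) =
  cong₂ _+_ (cong indicator (df≡dg 0)) (count-applyUpTo-cong d (f ∘ suc) (g ∘ suc) (df≡dg ∘ suc) n)

fromTo-cons : ∀ {lo hi} → lo ≤ hi → fromTo lo hi ≡ lo ∷ fromTo (suc lo) hi
fromTo-cons {lo} {hi} lo≤hi = begin
  map (lo +_) (upTo (suc hi ∸ lo))
    ≡⟨ cong (map (lo +_) ∘ upTo) (+-∸-assoc 1 lo≤hi) ⟩
  lo + 0 ∷ map (lo +_) (applyUpTo suc (hi ∸ lo))
    ≡⟨ cong₂ _∷_ (+-identityʳ lo) (map-applyUpTo suc (lo +_) (hi ∸ lo)) ⟩
  lo ∷ applyUpTo (λ t → lo + suc t) (hi ∸ lo)
    ≡⟨ cong (lo ∷_) (map-upTo (λ t → lo + suc t) (hi ∸ lo)) ⟨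
  lo ∷ map (λ t → lo + suc t) (upTo (hi ∸ lo))
    ≡⟨ cong (lo ∷_) (map-cong (+-suc lo) (upTo (hi ∸ lo))) ⟩
  lo ∷ fromTo (suc lo) hi ∎

fromTo-empty : ∀ {lo hi} → hi < lo → fromTo lo hi ≡ []
fromTo-empty {lo} hi<lo = cong (map (lo +_) ∘ upTo) (m≤n⇒m∸n≡0 hi<lo)

length-fromTo : ∀ lo hi → length (fromTo lo hi) ≡ suc hi ∸ lo
length-fromTo lo hi = trans (length-map (lo +_) (upTo (suc hi ∸ lo))) (length-upTo (suc hi ∸ lo))

∈-fromTo⁻ : ∀ {lo hi i} → i ∈ fromTo lo hi → lo ≤ i × i ≤ hi
∈-fromTo⁻ {lo} {hi} i∈ with ∈-map⁻ (lo +_) i∈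
... | t , t∈ , refl = m≤m+n lo t , lo+t≤hi
  where
  t<n : t < suc hi ∸ lo
  t<n = ∈-upTo⁻ t∈
  lo≤1+hi : lo ≤ suc hi
  lo≤1+hi = <⇒≤ (m∸n≢0⇒n<m (λ n≡0 → n≮0 (subst (t <_) n≡0 t<n)))
  lo+t≤hi : lo + t ≤ hi
  lo+t≤hi = subst (_≤ hi) (+-comm t lo) (≤-pred (m≤o∸n⇒m+n≤o (suc t) lo≤1+hi t<n))

sum-fromTo-cong : ∀ (f g : ℕ → ℕ) lo hi → (∀ i → lo ≤ i → i ≤ hi → f i ≡ g i) →
  sum (map f (fromTo lo hi)) ≡ sum (map g (fromTo lo hi))
sum-fromTo-cong f g lo hi f≡g =
  cong sum (map-cong-local (All.tabulate λ {i} i∈ → uncurry (f≡g i) (∈-fromTo⁻ i∈)))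

firstPairRow : (ℕ → Bool) → ℕ → ℕ → ℕ → ℕ
firstPairRow d lo hi i = count (λ j → d i ∧ d j ∧ not (any d (fromTo lo (i ∸ 1)))) (fromTo (suc i) hi)

firstPairRow-first : ∀ d {lo} hi → 1 ≤ lo →
  firstPairRow d lo hi lo ≡ indicator (d lo) * count d (fromTo (suc lo) hi)
firstPairRow-first d {lo} hi 1≤lo rewrite fromTo-empty {lo} {lo ∸ 1} (∸-monoʳ-< (s≤s z≤n) 1≤lo) =
  trans (count-∧ˡ (d lo) (λ j → d j ∧ true) (fromTo (suc lo) hi))
        (cong (indicator (d lo) *_) (count-cong (∧-identityʳ ∘ d) (fromTo (suc lo) hi)))

firstPairRow-later : ∀ d {lo} hi {i} → lo < i →
  firstPairRow d lo hi i ≡ indicator (not (d lo)) * firstPairRow d (suc lo) hi i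
firstPairRow-later d {lo} hi {i} lo<i rewrite fromTo-cons {lo} {i ∸ 1} (<⇒≤pred lo<i) with d lo
... | true  = trans
  (count-cong (λ j → trans (cong (d i ∧_) (∧-zeroʳ (d j))) (∧-zeroʳ (d i))) (fromTo (suc i) hi))
  (count-∧ˡ false (λ j → d i ∧ d j ∧ not (any d (fromTo (suc lo) (i ∸ 1)))) (fromTo (suc i) hi))
... | false = count-∧ˡ true _ (fromTo (suc i) hi)

indicator-+-∸1 : ∀ b c → (indicator b + c) ∸ 1 ≡ indicator b * c + indicator (not b) * (c ∸ 1)
indicator-+-∸1 true  c = sym (trans (+-identityʳ (1 * c)) (*-identityˡ c))
indicator-+-∸1 false c = sym (*-identityˡ (c ∸ 1))

-- Every hit of d in [lo, hi] other than the first one pairs up with the first one.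
count∸1≡firstPairs : ∀ (d : ℕ → Bool) lo hi → 1 ≤ lo →
  count d (fromTo lo hi) ∸ 1 ≡ sum (map (firstPairRow d lo hi) (fromTo lo (hi ∸ 1)))
count∸1≡firstPairs d lo₀ hi 1≤lo₀ = go (hi ∸ lo₀) lo₀ 1≤lo₀ refl
  where
  go : ∀ n lo → 1 ≤ lo → hi ∸ lo ≡ n →
    count d (fromTo lo hi) ∸ 1 ≡ sum (map (firstPairRow d lo hi) (fromTo lo (hi ∸ 1)))
  go zero lo 1≤lo hi∸lo≡0 = begin
    count d (fromTo lo hi) ∸ 1 ≡⟨ m≤n⇒m∸n≡0 count≤1 ⟩
    0                           ≡⟨ cong (sum ∘ map (firstPairRow d lo hi)) (fromTo-empty hi∸1<lo) ⟨
    sum (map (firstPairRow d lo hi) (fromTo lo (hi ∸ 1))) ∎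
    where
    hi≤lo : hi ≤ lo
    hi≤lo = m∸n≡0⇒m≤n hi∸lo≡0
    hi∸1<lo : hi ∸ 1 < lo
    hi∸1<lo = ≤-<-trans (∸-monoˡ-≤ 1 hi≤lo) (∸-monoʳ-< (s≤s z≤n) 1≤lo)
    count≤1 : count d (fromTo lo hi) ≤ 1
    count≤1 = ≤-trans (count≤length d (fromTo lo hi)) (subst (_≤ 1) (sym (length-fromTo lo hi))
      (≤-trans (∸-monoˡ-≤ lo (s≤s hi≤lo)) (≤-reflexive (m+n∸n≡m 1 lo))))
  go (suc n) lo 1≤lo hi∸lo≡1+n = begin
    count d (fromTo lo hi) ∸ 1
      ≡⟨ cong (λ xs → count d xs ∸ 1) (fromTo-cons (<⇒≤ lo<hi)) ⟩
    (indicator (d lo) + C) ∸ 1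
      ≡⟨ indicator-+-∸1 (d lo) C ⟩
    indicator (d lo) * C + indicator (not (d lo)) * (C ∸ 1)
      ≡⟨ cong₂ _+_ (firstPairRow-first d hi 1≤lo) (cong (indicator (not (d lo)) *_) (sym IH)) ⟨
    firstPairRow d lo hi lo + indicator (not (d lo)) * sum (map (firstPairRow d (suc lo) hi) later)
      ≡⟨ cong (firstPairRow d lo hi lo +_)
              (sum-map-*ˡ (indicator (not (d lo))) (firstPairRow d (suc lo) hi) later) ⟨
    firstPairRow d lo hi lo + sum (map (λ i → indicator (not (d lo)) * firstPairRow d (suc lo) hi i) later)
      ≡⟨ cong (firstPairRow d lo hi lo +_)
              (sum-fromTo-cong _ _ (suc lo) (hi ∸ 1) (λ i lo<i _ → firstPairRow-later d hi lo<i)) ⟨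
    firstPairRow d lo hi lo + sum (map (firstPairRow d lo hi) later)
      ≡⟨ cong (sum ∘ map (firstPairRow d lo hi)) (fromTo-cons (<⇒≤pred lo<hi)) ⟨
    sum (map (firstPairRow d lo hi) (fromTo lo (hi ∸ 1))) ∎
    where
    C = count d (fromTo (suc lo) hi)
    later = fromTo (suc lo) (hi ∸ 1)
    lo<hi : lo < hi
    lo<hi = m∸n≢0⇒n<m (λ hi∸lo≡0 → 1+n≢0 (trans (sym hi∸lo≡1+n) hi∸lo≡0))
    IH : C ∸ 1 ≡ sum (map (firstPairRow d (suc lo) hi) later)
    IH = go n (suc lo) (s≤s z≤n) (trans (sym (pred[m∸n]≡m∸[1+n] hi lo)) (cong pred hi∸lo≡1+n))

prime≢1 : ∀ {q} → Prime q → q ≢ 1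
prime≢1 q-prime = nonTrivial⇒≢1 {{prime⇒nonTrivial q-prime}}

prime∣prime⇒≡ : ∀ {q r} → Prime q → Prime r → q ∣ r → q ≡ r
prime∣prime⇒≡ q-prime r-prime q∣r with prime⇒irreducible r-prime q∣r
... | inj₁ q≡1 = contradiction q≡1 (prime≢1 q-prime)
... | inj₂ q≡r = q≡r

prime*prime∣⇔ : ∀ {q r n} → Prime q → Prime r → q ≢ r → q * r ∣ n ⇔ ((q ∣ n) × (r ∣ n))
prime*prime∣⇔ {q} {r} {n} q-prime r-prime q≢r =
  mk⇔ (λ qr∣n → m*n∣⇒m∣ q r qr∣n , m*n∣⇒n∣ q r qr∣n) both
  where
  both : (q ∣ n) × (r ∣ n) → q * r ∣ n
  both (divides k n≡kq , r∣n) with euclidsLemma k q r-prime (subst (r ∣_) n≡kq r∣n)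
  ... | inj₁ r∣k = subst (q * r ∣_) (sym (trans n≡kq (*-comm k q))) (*-monoʳ-∣ q r∣k)
  ... | inj₂ r∣q = contradiction (sym (prime∣prime⇒≡ r-prime q-prime r∣q)) q≢r

gcd≡1⇔coprime : ∀ {m n} → gcd m n ≡ 1 ⇔ Coprime m n
gcd≡1⇔coprime = mk⇔ gcd≡1⇒coprime coprime⇒gcd≡1

coprime-prime⇔∤ : ∀ {n q} → Prime q → Coprime n q ⇔ (¬ q ∣ n)
coprime-prime⇔∤ {n} {q} q-prime = mk⇔ (λ cop q∣n → prime≢1 q-prime (cop (q∣n , ∣-refl))) coprime
  where
  coprime : ¬ q ∣ n → Coprime n q
  coprime q∤n (i∣n , i∣q) with prime⇒irreducible q-prime i∣q
  ... | inj₁ i≡1 = i≡1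
  ... | inj₂ refl = contradiction i∣n q∤n

coprime-*ʳ⇔ : ∀ {n a b} → Coprime n (a * b) ⇔ (Coprime n a × Coprime n b)
coprime-*ʳ⇔ {n} {a} {b} = mk⇔
  (λ cop → (λ {_} (i∣n , i∣a) → cop (i∣n , ∣m⇒∣m*n b i∣a)) , (λ {_} (i∣n , i∣b) → cop (i∣n , ∣n⇒∣m*n a i∣b)))
  (λ (cop-a , cop-b) {_} (i∣n , i∣ab) →
     cop-b (i∣n , coprime-divisor (λ {_} (j∣i , j∣a) → cop-a (∣-trans j∣i i∣n , j∣a)) i∣ab))

gcd-product≡1 : ∀ n {qs} → All Prime qs →
  does (gcd n (product qs) ≟ 1) ≡ not (any (λ q → does (q ∣? n)) qs)
gcd-product≡1 n {[]}     []                   = dec-true (gcd n 1 ≟ 1) (gcd-zeroʳ n)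
gcd-product≡1 n {q ∷ qs} (q-prime ∷ qs-prime) = begin
  does (gcd n (q * product qs) ≟ 1)
    ≡⟨ does-⇔ gcd≡1-split (gcd n (q * product qs) ≟ 1) (¬? (q ∣? n) ×-dec (gcd n (product qs) ≟ 1)) ⟩
  not (does (q ∣? n)) ∧ does (gcd n (product qs) ≟ 1)
    ≡⟨ cong (not (does (q ∣? n)) ∧_) (gcd-product≡1 n qs-prime) ⟩
  not (does (q ∣? n)) ∧ not (any (λ q → does (q ∣? n)) qs)
    ≡⟨ deMorgan₂ (does (q ∣? n)) _ ⟨
  not (any (λ q → does (q ∣? n)) (q ∷ qs)) ∎
  where
  gcd≡1-split : gcd n (q * product qs) ≡ 1 ⇔ (¬ q ∣ n × gcd n (product qs) ≡ 1)
  gcd≡1-split = (coprime-prime⇔∤ q-prime ×-⇔ ⇔-sym gcd≡1⇔coprime) ⇔-∘ (coprime-*ʳ⇔ ⇔-∘ gcd≡1⇔coprime)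

-- Opened only locally: ℤ's +_ makes ℕ sections such as (x +_) ambiguous.
module _ where
  open import Data.Integer using (+_)

  interval-suc : ∀ b m → interval b (suc m) ≡ b +ᶻ + 1 ∷ interval (b +ᶻ + 1) m
  interval-suc b m = cong (b +ᶻ + 1 ∷_) (begin
    map (λ t → b +ᶻ + suc t) (applyUpTo suc m)
      ≡⟨ cong (map (λ t → b +ᶻ + suc t)) (map-upTo suc m) ⟨
    map (λ t → b +ᶻ + suc t) (map suc (upTo m))
      ≡⟨ map-∘ (upTo m) ⟨
    map (λ t → b +ᶻ + suc (suc t)) (upTo m)
      ≡⟨ map-cong (λ t → sym (ℤ.+-assoc b (+ 1) (+ suc t))) (upTo m) ⟩
    interval (b +ᶻ + 1) m ∎)

  <⇒+1≤ : ∀ {b a} → b <ᶻ a → b +ᶻ + 1 ≤ᶻ a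
  <⇒+1≤ {b} b<a = subst (_≤ᶻ _) (ℤ.+-comm (+ 1) b) (ℤ.i<j⇒suc[i]≤j b<a)

  <+1 : ∀ b → b <ᶻ b +ᶻ + 1
  <+1 b = subst (_<ᶻ b +ᶻ + 1) (ℤ.+-identityʳ b) (ℤ.+-monoʳ-< b (ℤ.+<+ (s≤s z≤n)))

  multiples-gap : ∀ {d u v} → d ∣ ∣ u ∣ → d ∣ ∣ v ∣ → u <ᶻ v → u +ᶻ + d ≤ᶻ v
  multiples-gap {d} {u} {v} d∣u d∣v u<v =
    subst (u +ᶻ + d ≤ᶻ_) (u+[v-u]≡v u v) (ℤ.+-monoʳ-≤ u d≤v-u)
    where
    u+[v-u]≡v : ∀ u v → u +ᶻ (v -ᶻ u) ≡ v
    u+[v-u]≡v = ℤ-solve-∀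
    0≤v-u : + 0 ≤ᶻ v -ᶻ u
    0≤v-u = ℤ.i≤j⇒0≤j-i (ℤ.<⇒≤ u<v)
    d∣v-u : d ∣ ∣ v -ᶻ u ∣
    d∣v-u = ℤ.∣⇒∣ᵤ (ℤ.∣m∣n⇒∣m-n (ℤ.∣ᵤ⇒∣ {+ d} {v} d∣v) (ℤ.∣ᵤ⇒∣ {+ d} {u} d∣u))
    v-u≢0 : ∣ v -ᶻ u ∣ ≢ 0
    v-u≢0 ∣v-u∣≡0 = ℤ.<-irrefl (sym (ℤ.i-j≡0⇒i≡j v u (trans (sym (ℤ.0≤i⇒+∣i∣≡i 0≤v-u)) (cong +_ ∣v-u∣≡0)))) u<v
    d≤v-u : + d ≤ᶻ v -ᶻ u
    d≤v-u = subst (+ d ≤ᶻ_) (ℤ.0≤i⇒+∣i∣≡i 0≤v-u) (ℤ.+≤+ (∣⇒≤ {{≢-nonZero v-u≢0}} d∣v-u))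

  multipleOf? : ∀ d → Decidable (λ (a : ℤ) → d ∣ ∣ a ∣)
  multipleOf? d a = d ∣? ∣ a ∣

  IsFirstMultipleAfter : ℕ → ℤ → ℤ → Set
  IsFirstMultipleAfter d b z = d ∣ ∣ z ∣ × b <ᶻ z × (∀ a → b <ᶻ a → d ∣ ∣ a ∣ → z ≤ᶻ a)

  first-multiple : ∀ d m b → 1 ≤ F b m d → ∃ λ z → IsFirstMultipleAfter d b z × z ≤ᶻ b +ᶻ + m
  first-multiple d (suc m) b 1≤F
    with multipleOf? d (b +ᶻ + 1) | subst ((1 ≤_) ∘ length ∘ filter (multipleOf? d)) (interval-suc b m) 1≤F
  ... | yes d∣b+1 | _ = b +ᶻ + 1 , (d∣b+1 , <+1 b , λ a b<a _ → <⇒+1≤ b<a) , ℤ.+-monoʳ-≤ b (ℤ.+≤+ (s≤s z≤n))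
  ... | no  d∤b+1 | 1≤F′ with first-multiple d m (b +ᶻ + 1) 1≤F′
  ...   | z , (d∣z , b+1<z , z-least) , z≤b+1+m =
    z , (d∣z , ℤ.<-trans (<+1 b) b+1<z , z-least-after-b) , subst (z ≤ᶻ_) (ℤ.+-assoc b (+ 1) (+ m)) z≤b+1+m
    where
    z-least-after-b : ∀ a → b <ᶻ a → d ∣ ∣ a ∣ → z ≤ᶻ a
    z-least-after-b a b<a d∣a =
      z-least a (ℤ.≤∧≢⇒< (<⇒+1≤ b<a) (λ b+1≡a → d∤b+1 (subst (λ x → d ∣ ∣ x ∣) (sym b+1≡a) d∣a))) d∣a

  arithProgression : ℤ → ℕ → ℕ → ℤ
  arithProgression z d t = z +ᶻ + t *ᶻ + d

  filter-multiples : ∀ {d} m {b z} → 1 ≤ d → IsFirstMultipleAfter d b z →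
    filter (multipleOf? d) (interval b m) ≡ applyUpTo (arithProgression z d) (F b m d)
  filter-multiples zero _ _ = refl
  filter-multiples {d} (suc m) {b} {z} 1≤d (d∣z , b<z , z-least) = begin
    filter (multipleOf? d) (interval b (suc m))
      ≡⟨ cong (filter (multipleOf? d)) (interval-suc b m) ⟩
    filter (multipleOf? d) (b +ᶻ + 1 ∷ interval (b +ᶻ + 1) m)
      ≡⟨ from-b+1 ⟩
    applyUpTo (arithProgression z d) (length (filter (multipleOf? d) (b +ᶻ + 1 ∷ interval (b +ᶻ + 1) m)))
      ≡⟨ cong (applyUpTo (arithProgression z d) ∘ length ∘ filter (multipleOf? d)) (interval-suc b m) ⟨
    applyUpTo (arithProgression z d) (F b (suc m) d) ∎
    where
    from-b+1 : filter (multipleOf? d) (b +ᶻ + 1 ∷ interval (b +ᶻ + 1) m)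
      ≡ applyUpTo (arithProgression z d) (length (filter (multipleOf? d) (b +ᶻ + 1 ∷ interval (b +ᶻ + 1) m)))
    from-b+1 with multipleOf? d (b +ᶻ + 1)
    ... | yes d∣b+1 = cong₂ _∷_ (trans b+1≡z (sym (z+0*d≡z z (+ d))))
      (trans (filter-multiples m 1≤d (d∣z+d , b+1<z+d , z+d-least))
             (applyUpTo-cong (λ t → z+d+t*d≡z+[1+t]*d z (+ d) (+ t)) (F (b +ᶻ + 1) m d)))
      where
      z+0*d≡z : ∀ z d → z +ᶻ + 0 *ᶻ d ≡ z
      z+0*d≡z = ℤ-solve-∀
      z+d+t*d≡z+[1+t]*d : ∀ z d t → (z +ᶻ d) +ᶻ t *ᶻ d ≡ z +ᶻ (+ 1 +ᶻ t) *ᶻ d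
      z+d+t*d≡z+[1+t]*d = ℤ-solve-∀
      b+1≡z : b +ᶻ + 1 ≡ z
      b+1≡z = ℤ.≤-antisym (<⇒+1≤ b<z) (z-least (b +ᶻ + 1) (<+1 b) d∣b+1)
      d∣z+d : d ∣ ∣ z +ᶻ + d ∣
      d∣z+d = ℤ.∣⇒∣ᵤ (ℤ.∣m∣n⇒∣m+n (ℤ.∣ᵤ⇒∣ {+ d} {z} d∣z) ℤ.∣-refl)
      b+1<z+d : b +ᶻ + 1 <ᶻ z +ᶻ + d
      b+1<z+d = subst (_<ᶻ z +ᶻ + d) (trans (ℤ.+-identityʳ z) (sym b+1≡z)) (ℤ.+-monoʳ-< z (ℤ.+<+ 1≤d))
      z+d-least : ∀ a → b +ᶻ + 1 <ᶻ a → d ∣ ∣ a ∣ → z +ᶻ + d ≤ᶻ a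
      z+d-least a b+1<a d∣a = multiples-gap d∣z d∣a (subst (_<ᶻ a) b+1≡z b+1<a)
    ... | no d∤b+1 = filter-multiples m 1≤d (d∣z , b+1<z , λ a b+1<a → z-least a (ℤ.<-trans (<+1 b) b+1<a))
      where
      b+1<z : b +ᶻ + 1 <ᶻ z
      b+1<z = ℤ.≤∧≢⇒< (<⇒+1≤ b<z) (λ b+1≡z → d∤b+1 (subst (λ x → d ∣ ∣ x ∣) (sym b+1≡z) d∣z))

  count-multiples : ∀ (g : ℤ → Bool) {d} m {b z} → 1 ≤ d → IsFirstMultipleAfter d b z →
    count (λ a → does (multipleOf? d a) ∧ g a) (interval b m)
      ≡ count g (applyUpTo (arithProgression z d) (F b m d))
  count-multiples g {d} m {b} 1≤d z-first =
    trans (count-∧-filter (multipleOf? d) g (interval b m)) (cong (count g) (filter-multiples m 1≤d z-first))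

  count-no-multiples : ∀ (g : ℤ → Bool) {d} b m → F b m d ≡ 0 →
    count (λ a → does (multipleOf? d a) ∧ g a) (interval b m) ≡ 0
  count-no-multiples g {d} b m F≡0 = n≤0⇒n≡0 (≤-trans
    (≤-reflexive (count-∧-filter (multipleOf? d) g (interval b m)))
    (subst (count g (filter (multipleOf? d) (interval b m)) ≤_) F≡0
           (count≤length g (filter (multipleOf? d) (interval b m)))))

  first-multiple-shift : ∀ {d b m z} → IsFirstMultipleAfter d b z → z ≤ᶻ b +ᶻ + m →
    IsFirstMultipleShift b m d (z -ᶻ + d)
  first-multiple-shift {d} {b} {m} {z} (d∣z , b<z , z-least) z≤b+m = subst
    (λ w → (b <ᶻ w) × (w ≤ᶻ b +ᶻ + m) × (d ∣ ∣ w ∣) × (∀ a → b <ᶻ a → a ≤ᶻ b +ᶻ + m → d ∣ ∣ a ∣ → w ≤ᶻ a))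
    (sym ([z-d]+d≡z z (+ d))) (b<z , z≤b+m , d∣z , λ a b<a _ → z-least a b<a)
    where
    [z-d]+d≡z : ∀ z d → (z -ᶻ d) +ᶻ d ≡ z
    [z-d]+d≡z = ℤ-solve-∀

  arithProgression-shift : ∀ z d t → arithProgression z d t ≡ (z -ᶻ + d) +ᶻ + suc t *ᶻ + d
  arithProgression-shift z d t = z+t*d≡[z-d]+[1+t]*d z (+ d) (+ t)
    where
    z+t*d≡[z-d]+[1+t]*d : ∀ z d t → z +ᶻ t *ᶻ d ≡ (z -ᶻ d) +ᶻ (+ 1 +ᶻ t) *ᶻ d
    z+t*d≡[z-d]+[1+t]*d = ℤ-solve-∀

  interval≡applyUpTo : ∀ c n → interval c n ≡ applyUpTo (λ t → c +ᶻ + suc t) n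
  interval≡applyUpTo c n = map-upTo (λ t → c +ᶻ + suc t) n

coprimeToPrimorial : (ℕ → ℕ) → ℕ → ℤ → Bool
coprimeToPrimorial p t a = does (gcd ∣ a ∣ (primorial p t) ≟ 1)

-- The pairs (i, j) of the decomposition of ω_k(a) ∸ 1 with i = 1, resp. with i ≥ 2.
evenPairs : (ℕ → ℕ) → ℕ → ℤ → ℕ
evenPairs p k a = count (λ j → does (2 * p j ∣? ∣ a ∣)) (fromTo 2 k)

oddPairs : (ℕ → ℕ) → ℕ → ℤ → ℕ
oddPairs p k a =
  sum (map (λ i → count (λ j → does (p i * p j ∣? ∣ a ∣) ∧ coprimeToPrimorial p (i ∸ 1) a) (fromTo (suc i) k))
           (fromTo 2 (k ∸ 1)))

module _ {p : ℕ → ℕ} (enum : IsPrimeEnumeration p) where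
  open import Data.Integer using (+_)

  p-prime : ∀ {i} → 1 ≤ i → Prime (p i)
  p-prime = proj₁ enum _

  p-positive : ∀ {i} → 1 ≤ i → 1 ≤ p i
  p-positive 1≤i = <⇒≤ (nonTrivial⇒n>1 (p _) {{prime⇒nonTrivial (p-prime 1≤i)}})

  p-distinct : ∀ {i j} → 1 ≤ i → i < j → p i ≢ p j
  p-distinct 1≤i i<j = <⇒≢ (proj₁ (proj₂ enum) _ _ 1≤i i<j)

  p[1]≡2 : p 1 ≡ 2
  p[1]≡2 with proj₂ (proj₂ enum) 2 prime[2]
  ... | suc zero    , _ , p[1]≡2   = p[1]≡2
  ... | suc (suc i) , _ , p[2+i]≡2 =
    contradiction (nonTrivial⇒n>1 (p 1) {{prime⇒nonTrivial (p-prime ≤-refl)}})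
                  (<⇒≱ (subst (p 1 <_) p[2+i]≡2 (proj₁ (proj₂ enum) 1 (2 + i) ≤-refl (s≤s (s≤s z≤n)))))

  hasFactor : ℤ → ℕ → Bool
  hasFactor a l = does (p l ∣? ∣ a ∣)

  p*p∣?≡∧ : ∀ {i j} n → 1 ≤ i → i < j → does (p i * p j ∣? n) ≡ does (p i ∣? n) ∧ does (p j ∣? n)
  p*p∣?≡∧ n 1≤i i<j = does-⇔ (prime*prime∣⇔ (p-prime 1≤i) (p-prime (≤-trans 1≤i (<⇒≤ i<j))) (p-distinct 1≤i i<j))
                            (_ ∣? n) ((_ ∣? n) ×-dec (_ ∣? n))

  coprimeToPrimorial≡noFactor : ∀ t a → coprimeToPrimorial p t a ≡ not (any (hasFactor a) (fromTo 1 t))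
  coprimeToPrimorial≡noFactor t a = trans
    (gcd-product≡1 ∣ a ∣ {map p (fromTo 1 t)} (All.map⁺ (All.tabulate λ l∈ → p-prime (proj₁ (∈-fromTo⁻ l∈)))))
    (cong (not ∘ or) (sym (map-∘ (fromTo 1 t))))

  omega∸1≡pairs : ∀ k a → omega p k a ∸ 1 ≡ evenPairs p k a + oddPairs p k a
  omega∸1≡pairs k a = begin
    omega p k a ∸ 1
      ≡⟨ cong (_∸ 1) (length-filter≡count (λ l → p l ∣? ∣ a ∣) (fromTo 1 k)) ⟩
    count (hasFactor a) (fromTo 1 k) ∸ 1
      ≡⟨ count∸1≡firstPairs (hasFactor a) 1 k ≤-refl ⟩
    sum (map (firstPairRow (hasFactor a) 1 k) (fromTo 1 (k ∸ 1)))
      ≡⟨ peel-first-row k ⟩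
    firstPairRow (hasFactor a) 1 k 1 + sum (map (firstPairRow (hasFactor a) 1 k) (fromTo 2 (k ∸ 1)))
      ≡⟨ cong₂ _+_ (sum-fromTo-cong _ _ 2 k (λ j 2≤j _ → cong indicator (row-1 j 2≤j)))
                   (sum-fromTo-cong _ _ 2 (k ∸ 1) (λ i 2≤i _ →
                      sum-fromTo-cong _ _ (suc i) k (λ j i<j _ → cong indicator (row-i i j 2≤i i<j)))) ⟩
    evenPairs p k a + oddPairs p k a ∎
    where
    peel-first-row : ∀ k → sum (map (firstPairRow (hasFactor a) 1 k) (fromTo 1 (k ∸ 1)))
      ≡ firstPairRow (hasFactor a) 1 k 1 + sum (map (firstPairRow (hasFactor a) 1 k) (fromTo 2 (k ∸ 1)))
    peel-first-row zero          = refl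
    peel-first-row (suc zero)    = refl
    peel-first-row (suc (suc k)) =
      cong (sum ∘ map (firstPairRow (hasFactor a) 1 (2 + k))) (fromTo-cons {1} {suc k} (s≤s z≤n))
    row-1 : ∀ j → 2 ≤ j → hasFactor a 1 ∧ hasFactor a j ∧ true ≡ does (2 * p j ∣? ∣ a ∣)
    row-1 j 2≤j = begin
      hasFactor a 1 ∧ hasFactor a j ∧ true ≡⟨ cong (hasFactor a 1 ∧_) (∧-identityʳ (hasFactor a j)) ⟩
      hasFactor a 1 ∧ hasFactor a j        ≡⟨ p*p∣?≡∧ ∣ a ∣ ≤-refl 2≤j ⟨
      does (p 1 * p j ∣? ∣ a ∣)        ≡⟨ cong (λ q → does (q * p j ∣? ∣ a ∣)) p[1]≡2 ⟩
      does (2 * p j ∣? ∣ a ∣)          ∎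
    row-i : ∀ i j → 2 ≤ i → i < j →
      hasFactor a i ∧ hasFactor a j ∧ not (any (hasFactor a) (fromTo 1 (i ∸ 1)))
        ≡ does (p i * p j ∣? ∣ a ∣) ∧ coprimeToPrimorial p (i ∸ 1) a
    row-i i j 2≤i i<j = sym (trans
      (cong₂ _∧_ (p*p∣?≡∧ ∣ a ∣ (≤-trans (s≤s z≤n) 2≤i) i<j) (coprimeToPrimorial≡noFactor (i ∸ 1) a))
      (∧-assoc (hasFactor a i) (hasFactor a j) _))

  sum-evenPairs : ∀ b m k →
    sum (map (evenPairs p k) (interval b m)) ≡ sum (map (λ j → F b m (2 * p j)) (fromTo 2 k))
  sum-evenPairs b m k = trans
    (sum-map-swap (λ a j → indicator (does (2 * p j ∣? ∣ a ∣))) (interval b m) (fromTo 2 k))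
    (cong sum (map-cong (λ j → sym (length-filter≡count (λ a → 2 * p j ∣? ∣ a ∣) (interval b m)))
                        (fromTo 2 k)))

  count-multiples≡phi : ∀ {b m k c} → ValidC p b m k c → ∀ {i j} → 2 ≤ i → i < j → j ≤ k →
    count (λ a → does (p i * p j ∣? ∣ a ∣) ∧ coprimeToPrimorial p (i ∸ 1) a) (interval b m)
      ≡ phi p (c i j) (F b m (p i * p j)) (i ∸ 1)
  count-multiples≡phi {b} {m} {k} {c} valid {i} {j} 2≤i i<j j≤k = for-F≡ (F b m d) refl
    where
    d = p i * p j
    g = coprimeToPrimorial p (i ∸ 1)
    1≤d : 1 ≤ d
    1≤d = *-mono-≤ (p-positive (≤-trans (s≤s z≤n) 2≤i)) (p-positive (≤-trans (s≤s z≤n) (≤-trans 2≤i (<⇒≤ i<j))))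
    positive : ∀ {n} → F b m d ≡ suc n → 1 ≤ F b m d
    positive F≡1+n = subst (1 ≤_) (sym F≡1+n) (s≤s z≤n)

    for-F≡ : ∀ n → F b m d ≡ n →
      count (λ a → does (multipleOf? d a) ∧ g a) (interval b m) ≡ phi p (c i j) n (i ∸ 1)
    for-F≡ zero    F≡0   = count-no-multiples g b m F≡0
    for-F≡ (suc n) F≡1+n with first-multiple d m b (positive F≡1+n)
    ... | z , z-first , z≤b+m = begin
      count (λ a → does (multipleOf? d a) ∧ g a) (interval b m)
        ≡⟨ count-multiples g m 1≤d z-first ⟩
      count g (applyUpTo (arithProgression z d) (F b m d))
        ≡⟨ cong (count g ∘ applyUpTo (arithProgression z d)) F≡1+n ⟩
      count g (applyUpTo (arithProgression z d) (suc n))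
        ≡⟨ count-applyUpTo-cong g (arithProgression z d) (λ t → c i j +ᶻ + suc t) same-coprimality (suc n) ⟩
      count g (applyUpTo (λ t → c i j +ᶻ + suc t) (suc n))
        ≡⟨ cong (count g) (interval≡applyUpTo (c i j) (suc n)) ⟨
      count g (interval (c i j) (suc n))
        ≡⟨ length-filter≡count (λ a → gcd ∣ a ∣ (primorial p (i ∸ 1)) ≟ 1) (interval (c i j) (suc n)) ⟨
      phi p (c i j) (suc n) (i ∸ 1) ∎
      where
      same-coprimality : ∀ t → g (arithProgression z d t) ≡ g (c i j +ᶻ + suc t)
      same-coprimality t = cong (λ x → does (x ≟ 1)) (begin
        gcd (∣ arithProgression z d t ∣) (primorial p (i ∸ 1))
          ≡⟨ cong (λ x → gcd ∣ x ∣ (primorial p (i ∸ 1))) (arithProgression-shift z d t) ⟩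
        gcd (∣ (z -ᶻ + d) +ᶻ + suc t *ᶻ + d ∣) (primorial p (i ∸ 1))
          ≡⟨ valid i j 2≤i i<j j≤k (positive F≡1+n)
                   (z -ᶻ + d) (first-multiple-shift z-first z≤b+m) (+ suc t) ⟨
        gcd (∣ c i j +ᶻ + suc t ∣) (primorial p (i ∸ 1)) ∎)

  sum-oddPairs : ∀ {b m k c} → ValidC p b m k c →
    sum (map (oddPairs p k) (interval b m))
      ≡ sum (map (λ i → sum (map (λ j → phi p (c i j) (F b m (p i * p j)) (i ∸ 1)) (fromTo (suc i) k)))
                 (fromTo 2 (k ∸ 1)))
  sum-oddPairs {b} {m} {k} {c} valid = trans
    (sum-map-swap (λ a i → count (pair i a) (fromTo (suc i) k)) (interval b m) (fromTo 2 (k ∸ 1)))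
    (sum-fromTo-cong _ _ 2 (k ∸ 1) λ i 2≤i i≤k-1 → trans
      (sum-map-swap (λ a j → indicator (pair i a j)) (interval b m) (fromTo (suc i) k))
      (sum-fromTo-cong _ _ (suc i) k λ j i<j j≤k → count-multiples≡phi {c = c} valid 2≤i i<j j≤k))
    where
    pair : ℕ → ℤ → ℕ → Bool
    pair i a j = does (p i * p j ∣? ∣ a ∣) ∧ coprimeToPrimorial p (i ∸ 1) a

theorem3p3 : (p : ℕ → ℕ) → IsPrimeEnumeration p →
    (b : ℤ) (m k : ℕ) → 1 ≤ k →
    (c : ℕ → ℕ → ℤ) → ValidC p b m k c →
    lhs p b m k ≡ rhs p b m k c
theorem3p3 p enum b m k _ c valid = begin
  lhs p b m k
    ≡⟨ sum-map-filter (λ a → 0 <? omega p k a) (λ a → omega p k a ∸ 1) (interval b m)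
                      (λ a ω≯0 → cong (_∸ 1) (n≤0⇒n≡0 (≮⇒≥ ω≯0))) ⟩
  sum (map (λ a → omega p k a ∸ 1) (interval b m))
    ≡⟨ cong sum (map-cong (omega∸1≡pairs enum k) (interval b m)) ⟩
  sum (map (λ a → evenPairs p k a + oddPairs p k a) (interval b m))
    ≡⟨ sum-map-+ (evenPairs p k) (oddPairs p k) (interval b m) ⟩
  sum (map (evenPairs p k) (interval b m)) + sum (map (oddPairs p k) (interval b m))
    ≡⟨ cong₂ _+_ (sum-evenPairs enum b m k) (sum-oddPairs enum {c = c} valid) ⟩
  rhs p b m k c ∎
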